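{- Let $l\ge 1$ be an odd integer and let $p\ge l^2+3l+5$ be a prime. Let $a$ be the integer with $0\le a\le p-1$ and $(l+2)a\equiv 2 \pmod p$. Then $$a\in \Big[l+2,\frac{p-l-2}{2}\Big]\cup \Big[\frac{p+l+2}{2},p-l-2\Big].$$ -}

module Defs where

module Submission where

-- Let k = l + 2 and let a ∈ [0, p) be the residue of 2·k⁻¹ modulo p.
-- We show that a avoids the four "forbidden windows" of width k:
--   (i)   a < k              : then k·a < p, so k·a = 2, impossible for k ≥ 3;
--   (ii)  p - k < a          : with a + b = p, b < k, we get p ∣ 2 + k·b,
--                              but 0 < 2 + k·b < p;
--   (iii) p ≤ 2a < p + k     : with p + d = 2a, d < k, k·d ≡ 4 and k·d < p,
--                              so k·d = 4, impossible for odd k ≥ 3;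
--   (iv)  p - k < 2a < p     : with 2a + e = p, e < k, p ∣ 4 + k·e; if e < k - 1
--                              then 0 < 4 + k·e < p, and if e = k - 1 (even)
--                              then p = 2a + e is even.
-- Every case is an instance of one principle (residues-unique): two numbers
-- below p that are congruent modulo p are equal.  The file first proves the
-- arithmetic tools, then the position theorem for an arbitrary odd k ≥ 3 with
-- k(k-1) + 3 ≤ p (module Position, theorem inverse-position), and finally
-- lemma4 as the instance k = l + 2, using l² + 3l + 5 = (l+2)(l+1) + 3.

open import Defs
open import Data.Nat using (ℕ; NonZero; _+_; _*_; _∸_; _^_; _≤_; _<_; _%_)
open import Data.Nat.Divisibility using (_∣_)
open import Data.Nat.Primality using (Prime)
open import Data.Sum using (_⊎_)
open import Data.Product using (_×_)
open import Relation.Nullary using (¬_)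
open import Relation.Binary.PropositionalEquality using (_≡_)

open import Data.Nat using (zero; suc; s≤s; s≤s⁻¹; z≤n; _≤?_; _/_)
open import Data.Nat.Properties
open import Data.Nat.DivMod using (m≡m%n+[m/n]*n; m<n⇒m%n≡m; [m+kn]%n≡m%n)
open import Data.Nat.Divisibility using (divides; ∣-refl; m∣m*n; ∣m∣n⇒∣m+n; ∣m+n∣m⇒∣n)
open import Data.Nat.Primality using (composite)
open import Data.Nat.Tactic.RingSolver using (solve-∀)
open import Algebra.Properties.CommutativeSemigroup +-commutativeSemigroup using (xy∙z≈xz∙y)
open import Algebra.Properties.CommutativeSemigroup *-commutativeSemigroup using () renaming (x∙yz≈y∙xz to *-left-comm)
open import Data.Empty using (⊥-elim)
open import Data.Product using (∃-syntax; _,_)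
open import Data.Sum using (inj₁; inj₂)
open import Function using (_∘_)
open import Relation.Nullary using (yes; no; contradiction)
open import Relation.Binary.PropositionalEquality using (_≢_; refl; sym; trans; cong; subst; module ≡-Reasoning)

open ≡-Reasoning

residues-unique : ∀ {p x y} c d .{{_ : NonZero p}} → x < p → y < p →
                  x + c * p ≡ y + d * p → x ≡ y
residues-unique {p} {x} {y} c d x<p y<p eq = begin
  x               ≡⟨ sym (m<n⇒m%n≡m x<p) ⟩
  x % p           ≡⟨ sym ([m+kn]%n≡m%n x c p) ⟩
  (x + c * p) % p ≡⟨ cong (_% p) eq ⟩
  (y + d * p) % p ≡⟨ [m+kn]%n≡m%n y d p ⟩
  y % p           ≡⟨ m<n⇒m%n≡m y<p ⟩
  y               ∎

complement-residue : ∀ k r c {x b p} → k * x ≡ r + c * p → x + b ≡ p →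
                     (r + k * b) + c * p ≡ 0 + k * p
complement-residue k r c {x} {b} {p} kx≡ x+b≡p = begin
  (r + k * b) + c * p ≡⟨ xy∙z≈xz∙y r (k * b) (c * p) ⟩
  (r + c * p) + k * b ≡⟨ cong (_+ k * b) (sym kx≡) ⟩
  k * x + k * b       ≡⟨ sym (*-distribˡ-+ k x b) ⟩
  k * (x + b)         ≡⟨ cong (k *_) x+b≡p ⟩
  k * p               ∎

excess-residue : ∀ k r c {x d p} → k * x ≡ r + c * p → p + d ≡ x →
                 k * d + k * p ≡ r + c * p
excess-residue k r c {x} {d} {p} kx≡ p+d≡x = begin
  k * d + k * p ≡⟨ sym (*-distribˡ-+ k d p) ⟩
  k * (d + p)   ≡⟨ cong (k *_) (trans (+-comm d p) p+d≡x) ⟩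
  k * x         ≡⟨ kx≡ ⟩
  r + c * p     ∎

multiple≢2 : ∀ {k} x → 3 ≤ k → k * x ≢ 2
multiple≢2 {k} zero    _   eq = contradiction (trans (sym (*-zeroʳ k)) eq) λ ()
multiple≢2 {k} (suc x) 3≤k eq =
  <⇒≱ ≤-refl (≤-trans 3≤k (≤-trans (m≤m*n k (suc x)) (≤-reflexive eq)))

odd-multiple≢4 : ∀ {k} x → 3 ≤ k → ¬ 2 ∣ k → k * x ≢ 4
odd-multiple≢4 {k} zero          _   _     eq = contradiction (trans (sym (*-zeroʳ k)) eq) λ ()
odd-multiple≢4 {k} (suc zero)    _   k-odd eq = k-odd (divides 2 (trans (sym (*-identityʳ k)) eq))
odd-multiple≢4 {k} (suc (suc x)) 3≤k _     eq =
  <⇒≱ (s≤s (s≤s (s≤s (s≤s (s≤s z≤n))))) (≤-trans (*-mono-≤ 3≤k (s≤s (s≤s z≤n))) (≤-reflexive eq))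

odd⇒pred-even : ∀ n → ¬ 2 ∣ suc n → 2 ∣ n
odd⇒pred-even zero          _   = divides 0 refl
odd⇒pred-even (suc zero)    odd = contradiction ∣-refl odd
odd⇒pred-even (suc (suc n)) odd = ∣m∣n⇒∣m+n ∣-refl (odd⇒pred-even n (odd ∘ ∣m∣n⇒∣m+n ∣-refl))

prime⇒odd : ∀ {p} → Prime p → 3 ≤ p → ¬ 2 ∣ p
prime⇒odd p-prime 3≤p 2∣p = Prime.notComposite p-prime (composite 3≤p 2∣p)

Within : ℕ → ℕ → ℕ → Set
Within k x y = ∃[ d ] (x + d ≡ y × d < k)

within : ∀ {k x y} → x ≤ y → ¬ (x + k ≤ y) → Within k x y
within {k} {x} {y} x≤y x+k≰y = y ∸ x , m+[n∸m]≡n x≤y , ≰⇒> k≰y∸x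
  where
  k≰y∸x : ¬ (k ≤ y ∸ x)
  k≰y∸x k≤y∸x = x+k≰y (subst (x + k ≤_) (m+[n∸m]≡n x≤y) (+-monoʳ-≤ x k≤y∸x))

module Position (n p a : ℕ) .{{_ : NonZero p}}
                (3≤k : 3 ≤ suc n) (k-odd : ¬ 2 ∣ suc n) (p-odd : ¬ 2 ∣ p)
                (bound : suc n * n + 3 ≤ p)
                (a<p : a < p) (inverse : (suc n * a) % p ≡ 2) where

  k : ℕ
  k = suc n

  q : ℕ
  q = (k * a) / p

  division : k * a ≡ 2 + q * p
  division = begin
    k * a               ≡⟨ m≡m%n+[m/n]*n (k * a) p ⟩
    (k * a) % p + q * p ≡⟨ cong (_+ q * p) inverse ⟩
    2 + q * p           ∎

  doubled : k * (2 * a) ≡ 4 + (2 * q) * p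
  doubled = begin
    k * (2 * a)       ≡⟨ *-left-comm k 2 a ⟩
    2 * (k * a)       ≡⟨ cong (2 *_) division ⟩
    2 * (2 + q * p)   ≡⟨ *-distribˡ-+ 2 2 (q * p) ⟩
    4 + 2 * (q * p)   ≡⟨ cong (4 +_) (sym (*-assoc 2 q p)) ⟩
    4 + (2 * q) * p   ∎

  small-multiple : ∀ {b} → b < k → 3 + k * b ≤ p
  small-multiple {b} b<k =
    ≤-trans (≤-reflexive (+-comm 3 (k * b))) (≤-trans (+-monoˡ-≤ 3 (*-monoʳ-≤ k (s≤s⁻¹ b<k))) bound)

  multiple<p : ∀ {b} → b < k → k * b < p
  multiple<p b<k = ≤-trans (m≤n+m _ 2) (small-multiple b<k)

  -- Since k ≥ 3, p ≥ 3·2 + 3; in particular 0, 2 and 4 are residues below p.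
  9≤p : 9 ≤ p
  9≤p = ≤-trans (+-monoʳ-≤ 3 (*-monoˡ-≤ 2 3≤k)) (small-multiple 3≤k)

  0<p : 0 < p
  0<p = ≤-trans (m≤m+n 1 8) 9≤p

  2<p : 2 < p
  2<p = ≤-trans (m≤m+n 3 6) 9≤p

  4<p : 4 < p
  4<p = ≤-trans (m≤m+n 5 4) 9≤p

  a-not-small : ¬ a < k
  a-not-small a<k =
    multiple≢2 a 3≤k (residues-unique 0 q (multiple<p a<k) 2<p (trans (+-identityʳ (k * a)) division))

  p-not-within-a : ¬ Within k a p
  p-not-within-a (b , a+b≡p , b<k) =
    contradiction (residues-unique q k (small-multiple b<k) 0<p
                                   (complement-residue k 2 q division a+b≡p)) λ ()

  2a-not-within-p : ¬ Within k p (2 * a)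
  2a-not-within-p (d , p+d≡2a , d<k) =
    odd-multiple≢4 d 3≤k k-odd (residues-unique k (2 * q) (multiple<p d<k) 4<p
                                                (excess-residue k 4 (2 * q) doubled p+d≡2a))

  p-not-within-2a : ¬ Within k (2 * a) p
  p-not-within-2a (e , 2a+e≡p , e<k) with m≤n⇒m<n∨m≡n (s≤s⁻¹ e<k)
  ... | inj₁ e<n = contradiction (residues-unique (2 * q) k 4+ke<p 0<p
                                                  (complement-residue k 4 (2 * q) doubled 2a+e≡p)) λ ()
    where
    -- 4 + k·e < 3 + k·(e + 1), as k ≥ 2.
    4+ke<p : 4 + k * e < p
    4+ke<p = ≤-trans (+-monoʳ-≤ 3 (+-monoˡ-≤ (k * e) (≤-trans (m≤n+m 2 1) 3≤k)))
                     (≤-trans (≤-reflexive (cong (3 +_) (sym (*-suc k e)))) (small-multiple (s≤s e<n)))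
  -- e = k - 1 is even, so p = 2a + e would be even.
  ... | inj₂ refl = p-odd (subst (2 ∣_) 2a+e≡p (∣m∣n⇒∣m+n (m∣m*n a) (odd⇒pred-even e k-odd)))

  k≤a : k ≤ a
  k≤a = ≮⇒≥ a-not-small

  a≤p∸k : a ≤ p ∸ k
  a≤p∸k with a ≤? p ∸ k
  ... | yes a≤p∸k = a≤p∸k
  ... | no  a≰p∸k = ⊥-elim (p-not-within-a (within (<⇒≤ a<p) (a≰p∸k ∘ m+n≤o⇒m≤o∸n a)))

  2a-outside : 2 * a ≤ p ∸ k ⊎ p + k ≤ 2 * a
  2a-outside with 2 * a ≤? p ∸ k | p + k ≤? 2 * a
  ... | yes below | _         = inj₁ below
  ... | no  _     | yes above = inj₂ above
  ... | no  ¬below | no ¬above with p ≤? 2 * a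
  ...   | yes p≤2a = ⊥-elim (2a-not-within-p (within p≤2a ¬above))
  ...   | no  p≰2a = ⊥-elim (p-not-within-2a (within (<⇒≤ (≰⇒> p≰2a)) (¬below ∘ m+n≤o⇒m≤o∸n (2 * a))))

  classify : (k ≤ a × 2 * a ≤ p ∸ k) ⊎ (p + k ≤ 2 * a × a ≤ p ∸ k)
  classify with 2a-outside
  ... | inj₁ below = inj₁ (k≤a , below)
  ... | inj₂ above = inj₂ (above , a≤p∸k)

inverse-position : ∀ k p a .{{_ : NonZero p}} → 3 ≤ k → ¬ 2 ∣ k → ¬ 2 ∣ p →
                   k * (k ∸ 1) + 3 ≤ p → a < p → (k * a) % p ≡ 2 →
                   (k ≤ a × 2 * a ≤ p ∸ k) ⊎ (p + k ≤ 2 * a × a ≤ p ∸ k)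
inverse-position zero    p a ()
inverse-position (suc n) p a = Position.classify n p a

quadratic : ∀ l → (l + 2) * (l + 2 ∸ 1) + 3 ≡ l ^ 2 + 3 * l + 5
quadratic l = begin
  (l + 2) * (l + 2 ∸ 1) + 3 ≡⟨ cong (λ x → (l + 2) * x + 3) (+-∸-assoc l (s≤s z≤n)) ⟩
  (l + 2) * (l + 1) + 3     ≡⟨ expand l ⟩
  l ^ 2 + 3 * l + 5         ∎
  where
  expand : ∀ l → (l + 2) * (l + 1) + 3 ≡ l * (l * 1) + 3 * l + 5
  expand = solve-∀

lemma4 : (l p a : ℕ) → .{{_ : NonZero p}} → 1 ≤ l → ¬ (2 ∣ l) → Prime p → l ^ 2 + 3 * l + 5 ≤ p →
         a < p → ((l + 2) * a) % p ≡ 2 % p →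
         (l + 2 ≤ a × 2 * a ≤ p ∸ l ∸ 2) ⊎ (p + l + 2 ≤ 2 * a × a ≤ p ∸ l ∸ 2)
lemma4 l p a 1≤l l-odd p-prime bound a<p inverse
  rewrite ∸-+-assoc p l 2 | +-assoc p l 2 =
  inverse-position (l + 2) p a (+-monoˡ-≤ 2 1≤l) k-odd (prime⇒odd p-prime 3≤p)
                   (subst (_≤ p) (sym (quadratic l)) bound) a<p (trans inverse (m<n⇒m%n≡m 3≤p))
  where
  3≤p : 3 ≤ p
  3≤p = ≤-trans (m≤m+n 3 2) (≤-trans (m≤n+m 5 (l ^ 2 + 3 * l)) bound)

  k-odd : ¬ 2 ∣ l + 2
  k-odd 2∣l+2 = l-odd (∣m+n∣m⇒∣n (subst (2 ∣_) (+-comm l 2) 2∣l+2) ∣-refl)
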